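{- Let $n$ be a positive integer with $n\equiv 3\pmod 4$. Then the Harary graph $H_{4,n}$ is $(a,1)$-distance antimagic for some integer $a$.
   Context: $H_{4,n}$ has vertices $v_0,\dots,v_{n-1}$ with $v_i\sim v_j$ iff $i\ne j$ and $j\equiv i+t\pmod n$ for some $t\in\{\pm1,\pm2\}$ (the square of the cycle $C_n$). For integers $a$ and $d\ge 0$, an $(a,d)$-distance antimagic labeling of a graph on $n$ vertices is a bijection $f:V\to\{1,\dots,n\}$ such that the set of vertex weights $\{\sum_{v\in N(u)}f(v)\}$ equals $\{a,a+d,\dots,a+(n-1)d\}$. -}

module Defs where

open import Data.Nat using (ℕ; zero; suc; _+_; _*_; _∸_; _≟_; NonZero)
open import Data.Nat.DivMod using (_%_)
open import Data.Fin using (Fin; toℕ)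
open import Data.Fin.Properties using () renaming (_≟_ to _≟ᶠ_)
open import Data.Bool using (Bool; true; false; _∧_; _∨_; not; if_then_else_)
open import Data.Integer using (ℤ; +_) renaming (_+_ to _+ℤ_)
open import Data.Product using (Σ; ∃; _×_; _,_)
open import Data.List using (List; map)
open import Data.Nat.ListAction using (sum)
open import Data.List using () renaming (allFin to allFinL)
open import Data.Fin using () renaming (_≟_ to _≟F_)
open import Function.Bundles using (Bijection)
open import Relation.Binary.PropositionalEquality using (_≡_; setoid)
open import Relation.Nullary.Decidable using (⌊_⌋)

congMod : (n : ℕ) {{_ : NonZero n}} → ℕ → ℕ → ℕ → Bool
congMod n i j t = ⌊ (j % n) ≟ ((i + t) % n) ⌋

-- Adjacency in H_{4,n} (square of C_n) on vertices v_0..v_{n-1} (as Fin n):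
-- v_i ~ v_j iff i ≠ j and j ≡ i + t (mod n) for some t ∈ {1, 2, -1, -2};
-- -t is represented by n - t (congruent mod n).
H4adj : (n : ℕ) {{_ : NonZero n}} → Fin n → Fin n → Bool
H4adj n i j =
  not ⌊ i ≟F j ⌋ ∧
  (congMod n (toℕ i) (toℕ j) 1 ∨ congMod n (toℕ i) (toℕ j) 2 ∨
   congMod n (toℕ i) (toℕ j) (n ∸ 1) ∨ congMod n (toℕ i) (toℕ j) (n ∸ 2))

-- Labels are 1..n: a bijection g : Fin n → Fin n, with f(v) = toℕ (g v) + 1.
label : {n : ℕ} → (Fin n → Fin n) → Fin n → ℕ
label g v = suc (toℕ (g v))

weight : (n : ℕ) {{_ : NonZero n}} → (Fin n → Fin n) → Fin n → ℕ
weight n g u = sum (map (λ v → if H4adj n u v then label g v else 0) (allFinL n))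

IsDistAntimagicH4 : (n : ℕ) {{_ : NonZero n}} → ℤ → ℕ → (Fin n → Fin n) → Set
IsDistAntimagicH4 n a d g =
  ((u : Fin n) → Σ (Fin n) λ k → + weight n g u ≡ a +ℤ (+ (toℕ k * d))) ×
  ((k : Fin n) → Σ (Fin n) λ u → + weight n g u ≡ a +ℤ (+ (toℕ k * d)))

H4DistAntimagic : (n : ℕ) {{_ : NonZero n}} → ℤ → ℕ → Set
H4DistAntimagic n a d =
  Σ (Bijection (setoid (Fin n)) (setoid (Fin n))) λ b →
    IsDistAntimagicH4 n a d (Bijection.to b)

-- Write n = 4k + 3. For k ≥ 1 give vertex v_x the label 1 + L(x), where the residue classes
-- 0, 2, 1, 3 (mod 4) of x take consecutive intervals of labels:
--   L(4q) = q,  L(4q+2) = 2k+1−q,  L(4q+1) = 3k+2−q,  L(4q+3) = 3k+3+q.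
-- Away from the seam between v_{n−1} and v_0 the weight is affine in q on each residue class, with
-- slope ±2, and the classes 4q+3, 4q, 4q+2, 4q+1 produce the offsets 4, 6, …, 2k+2;
-- 2k+4, …, 4k+2; 3, 5, …, 2k+1; 2k+5, …, 4k+1 above a = 6k+7. The four vertices at the seam,
-- v_{n−2}, v_{n−1}, v_1, v_0, supply the missing offsets 0, 1, 2, 2k+3. The value of a is forced:
-- every label lies in exactly four neighbourhoods, so the weights add up to 2n(n+1).
-- For n = 3 the graph is a triangle and the identity labelling works with a = 3.
module Submission where

open import Defs
open import Data.Nat
  using (ℕ; zero; suc; pred; _+_; _*_; _∸_; _≤_; _<_; z≤n; s≤s; z<s; s<s; NonZero; _%_; _/_; _<?_; _≤?_)
open import Data.Nat.Properties
open import Data.Nat.DivMod using (m<n⇒m%n≡m; %-distribˡ-+; [m+n]%n≡m%n; m%n<n; m≡m%n+[m/n]*n)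
open import Data.Nat.ListAction using (sum)
open import Data.Nat.Tactic.RingSolver using (solve)
open import Data.Fin using (Fin; toℕ; fromℕ<; punchOut) renaming (zero to fzero; suc to fsuc)
open import Data.Fin.Properties using (toℕ<n; toℕ-fromℕ<; toℕ-injective; any?; pigeonhole; punchOut-injective)
  renaming (_≟_ to _≟ᶠ_; <⇒≢ to <⇒≢ᶠ)
open import Data.Bool using (_∧_; _∨_; not; if_then_else_)
open import Data.List using (map; tabulate; _∷_; [])
open import Data.List.Properties using (tabulate-cong; map-tabulate)
open import Data.Integer using (ℤ)
import Data.Integer as ℤ
open import Data.Product using (∃; _×_; _,_; proj₁; proj₂)
open import Data.Sum using (_⊎_; inj₁; inj₂)
open import Data.Empty using (⊥-elim)
open import Function using (_∘_; id)
open import Function.Bundles using (mk↔ₛ′)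
open import Function.Properties.Inverse using (↔⇒⤖)
open import Relation.Nullary using (yes; no; does; contradiction)
open import Relation.Nullary.Decidable using (⌊_⌋; dec-true; dec-false)
open import Relation.Binary.PropositionalEquality
open import Algebra.Properties.CommutativeSemigroup +-commutativeSemigroup using (interchange)

-- A value y outside the image would make punchOut y ∘ f an injection of Fin (suc n) into Fin n.
injective⇒surjective : ∀ {n} (f : Fin n → Fin n) → (∀ {x y} → f x ≡ f y → x ≡ y) →
                       ∀ y → ∃ λ x → f x ≡ y
injective⇒surjective {suc n} f f-injective y with any? (λ x → f x ≟ᶠ y)
... | yes hit = hit
... | no miss with pigeonhole (n<1+n n) (λ x → punchOut {i = y} λ y≡fx → miss (x , sym y≡fx))
...   | i , j , i<j , collision =
  ⊥-elim (<⇒≢ᶠ i<j (f-injective (punchOut-injective {i = y} _ _ collision)))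

rightInverse⇒leftInverse : ∀ {n} (f h : Fin n → Fin n) → (∀ y → f (h y) ≡ y) → ∀ x → h (f x) ≡ x
rightInverse⇒leftInverse f h f∘h x
  with y , refl ← injective⇒surjective h (λ {a} {b} ha≡hb → trans (sym (f∘h a)) (trans (cong f ha≡hb) (f∘h b))) x
  = cong h (f∘h y)

-- Weights in the square of a cycle

-- does, not ⌊_⌋: ⌊_⌋ matches on the decision, so ⌊ suc x ≟ suc c ⌋ would not reduce to ⌊ x ≟ c ⌋.
indicator : ℕ → (ℕ → ℕ) → ℕ → ℕ
indicator c φ x = if does (x ≟ c) then φ x else 0

indicator-hit : ∀ c φ → indicator c φ c ≡ φ c
indicator-hit c φ = cong (λ b → if b then φ c else 0) (dec-true (c ≟ c) refl)

indicator-miss : ∀ {x c} φ → x ≢ c → indicator c φ x ≡ 0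
indicator-miss {x} {c} φ x≢c = cong (λ b → if b then φ x else 0) (dec-false (x ≟ c) x≢c)

sum-tabulate-+ : ∀ {m} (f h : Fin m → ℕ) →
                 sum (tabulate (λ v → f v + h v)) ≡ sum (tabulate f) + sum (tabulate h)
sum-tabulate-+ {zero}  f h = refl
sum-tabulate-+ {suc m} f h =
  trans (cong (f fzero + h fzero +_) (sum-tabulate-+ (f ∘ fsuc) (h ∘ fsuc)))
        (interchange (f fzero) (h fzero) _ _)

sum-indicator : ∀ {m} (φ : ℕ → ℕ) c → c < m → sum (tabulate {n = m} (indicator c φ ∘ toℕ)) ≡ φ c
sum-indicator {suc m} φ zero    _         = trans (cong (φ 0 +_) (sum-zeros m)) (+-identityʳ (φ 0))
  where
  sum-zeros : ∀ m → sum (tabulate {n = m} λ _ → 0) ≡ 0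
  sum-zeros zero    = refl
  sum-zeros (suc m) = sum-zeros m
sum-indicator {suc m} φ (suc c) (s≤s c<m) = sum-indicator (φ ∘ suc) c c<m

indicator-∨-split :
  ∀ (e c₁ c₂ c₃ c₄ : ℕ) (φ : ℕ → ℕ) x →
  e ≢ c₁ → e ≢ c₂ → e ≢ c₃ → e ≢ c₄ → c₁ ≢ c₂ → c₁ ≢ c₃ → c₁ ≢ c₄ → c₂ ≢ c₃ → c₂ ≢ c₄ → c₃ ≢ c₄ →
  (if not ⌊ e ≟ x ⌋ ∧ (⌊ x ≟ c₁ ⌋ ∨ ⌊ x ≟ c₂ ⌋ ∨ ⌊ x ≟ c₃ ⌋ ∨ ⌊ x ≟ c₄ ⌋) then φ x else 0)
  ≡ indicator c₁ φ x + (indicator c₂ φ x + (indicator c₃ φ x + indicator c₄ φ x))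
indicator-∨-split e c₁ c₂ c₃ c₄ φ x e≢c₁ e≢c₂ e≢c₃ e≢c₄ c₁≢c₂ c₁≢c₃ c₁≢c₄ c₂≢c₃ c₂≢c₄ c₃≢c₄
  with e ≟ x
... | yes refl
  rewrite indicator-miss φ e≢c₁ | indicator-miss φ e≢c₂ | indicator-miss φ e≢c₃ | indicator-miss φ e≢c₄ = refl
... | no _ with x ≟ c₁
... | yes refl
  rewrite indicator-hit x φ | indicator-miss φ c₁≢c₂ | indicator-miss φ c₁≢c₃ | indicator-miss φ c₁≢c₄ =
  sym (+-identityʳ (φ x))
... | no x≢c₁ with x ≟ c₂
... | yes refl
  rewrite indicator-miss φ x≢c₁ | indicator-hit x φ | indicator-miss φ c₂≢c₃ | indicator-miss φ c₂≢c₄ =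
  sym (+-identityʳ (φ x))
... | no x≢c₂ with x ≟ c₃
... | yes refl
  rewrite indicator-miss φ x≢c₁ | indicator-miss φ x≢c₂ | indicator-hit x φ | indicator-miss φ c₃≢c₄ =
  sym (+-identityʳ (φ x))
... | no x≢c₃ with x ≟ c₄
... | yes refl
  rewrite indicator-miss φ x≢c₁ | indicator-miss φ x≢c₂ | indicator-miss φ x≢c₃ | indicator-hit x φ = refl
... | no x≢c₄
  rewrite indicator-miss φ x≢c₁ | indicator-miss φ x≢c₂ | indicator-miss φ x≢c₃ | indicator-miss φ x≢c₄ = refl

%-shift-≢ : ∀ {N} .{{_ : NonZero N}} {y d} → y < N → suc d < N → (y + suc d) % N ≢ y
%-shift-≢ {N} {y} {d} y<N d<N with y + suc d <? N
... | yes y+d<N = λ eq → m+1+n≢m y (trans (sym (m<n⇒m%n≡m y+d<N)) eq)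
... | no y+d≮N = λ eq → <⇒≢ d<N (+-cancelˡ-≡ y _ _ (trans y+d≡z+N (cong (_+ N) (z≡y eq))))
  where
  z = y + suc d ∸ N
  y+d≡z+N : y + suc d ≡ z + N
  y+d≡z+N = sym (m∸n+n≡m (≮⇒≥ y+d≮N))
  z<N : z < N
  z<N = +-cancelʳ-< N z N (subst (_< N + N) y+d≡z+N (+-mono-< y<N d<N))
  z≡y : (y + suc d) % N ≡ y → z ≡ y
  z≡y eq = trans (sym (m<n⇒m%n≡m z<N))
             (trans (sym ([m+n]%n≡m%n z N)) (trans (cong (_% N) (sym y+d≡z+N)) eq))

+-%-distinct : ∀ N .{{_ : NonZero N}} e {s t} → s < t → t < N → (e + s) % N ≢ (e + t) % N
+-%-distinct N e {s} s<t t<N with d , s+1+d≡t ← m≤n⇒∃[o]m+o≡n s<t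
  rewrite trans (sym s+1+d≡t) (sym (+-suc s d)) = λ eq →
    %-shift-≢ (m%n<n (e + s) N) d<N (sym (trans eq shift))
  where
  d<N : suc d < N
  d<N = ≤-<-trans (m≤n+m (suc d) s) t<N
  shift : (e + (s + suc d)) % N ≡ ((e + s) % N + suc d) % N
  shift = begin
    (e + (s + suc d)) % N           ≡⟨ cong (_% N) (sym (+-assoc e s (suc d))) ⟩
    (e + s + suc d) % N             ≡⟨ %-distribˡ-+ (e + s) (suc d) N ⟩
    ((e + s) % N + suc d % N) % N   ≡⟨ cong (λ r → ((e + s) % N + r) % N) (m<n⇒m%n≡m d<N) ⟩
    ((e + s) % N + suc d) % N       ∎
    where open ≡-Reasoning

≟ᶠ-toℕ : ∀ {m} (u v : Fin m) → ⌊ u ≟ᶠ v ⌋ ≡ ⌊ toℕ u ≟ toℕ v ⌋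
≟ᶠ-toℕ u v with u ≟ᶠ v | toℕ u ≟ toℕ v
... | yes _   | yes _   = refl
... | no _    | no _    = refl
... | yes u≡v | no u≢v  = contradiction (cong toℕ u≡v) u≢v
... | no u≢v  | yes u≡v = contradiction (toℕ-injective u≡v) u≢v

cyclicNbrSum : (N : ℕ) .{{_ : NonZero N}} → (ℕ → ℕ) → ℕ → ℕ
cyclicNbrSum N φ x = φ ((x + 1) % N) + (φ ((x + 2) % N) + (φ ((x + (N ∸ 1)) % N) + φ ((x + (N ∸ 2)) % N)))

-- From five vertices on, the offsets 0, ±1, ±2 give distinct residues, so the adjacency test of
-- H4adj splits into four point indicators.
weight≡cyclicNbrSum : ∀ m (g : Fin (5 + m) → Fin (5 + m)) (φ : ℕ → ℕ) → (∀ v → label g v ≡ φ (toℕ v)) →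
                      ∀ u → weight (5 + m) g u ≡ cyclicNbrSum (5 + m) φ (toℕ u)
weight≡cyclicNbrSum m g φ label≡φ u = begin
  sum (map summand (tabulate id))           ≡⟨ cong sum (map-tabulate id summand) ⟩
  sum (tabulate summand)                    ≡⟨ cong sum (tabulate-cong summand≡indicators) ⟩
  sum (tabulate λ v → δ 1 v + (δ 2 v + (δ (4 + m) v + δ (3 + m) v)))
    ≡⟨ sum-tabulate-+ (δ 1) (λ v → δ 2 v + (δ (4 + m) v + δ (3 + m) v)) ⟩
  Σδ 1 + sum (tabulate λ v → δ 2 v + (δ (4 + m) v + δ (3 + m) v))
    ≡⟨ cong (Σδ 1 +_) (sum-tabulate-+ (δ 2) (λ v → δ (4 + m) v + δ (3 + m) v)) ⟩
  Σδ 1 + (Σδ 2 + sum (tabulate λ v → δ (4 + m) v + δ (3 + m) v))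
    ≡⟨ cong (λ s → Σδ 1 + (Σδ 2 + s)) (sum-tabulate-+ (δ (4 + m)) (δ (3 + m))) ⟩
  Σδ 1 + (Σδ 2 + (Σδ (4 + m) + Σδ (3 + m)))
    ≡⟨ cong₂ _+_ (Σδ≡φ 1) (cong₂ _+_ (Σδ≡φ 2) (cong₂ _+_ (Σδ≡φ (4 + m)) (Σδ≡φ (3 + m)))) ⟩
  cyclicNbrSum N φ e                        ∎
  where
  open ≡-Reasoning
  N = 5 + m
  e = toℕ u
  nbr : ℕ → ℕ
  nbr t = (e + t) % N
  summand : Fin N → ℕ
  summand v = if H4adj N u v then label g v else 0
  δ : ℕ → Fin N → ℕ
  δ t v = indicator (nbr t) φ (toℕ v)
  Σδ : ℕ → ℕ
  Σδ t = sum (tabulate (δ t))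
  Σδ≡φ : ∀ t → Σδ t ≡ φ (nbr t)
  Σδ≡φ t = sum-indicator φ (nbr t) (m%n<n (e + t) N)
  distinct : ∀ {s t} → s < t → t < N → nbr s ≢ nbr t
  distinct = +-%-distinct N e
  e≢nbr : ∀ {t} → 0 < t → t < N → e ≢ nbr t
  e≢nbr 0<t t<N e≡nbr =
    distinct 0<t t<N (trans (cong (_% N) (+-identityʳ e)) (trans (m<n⇒m%n≡m (toℕ<n u)) e≡nbr))
  summand≡indicators : ∀ v → summand v ≡ δ 1 v + (δ 2 v + (δ (4 + m) v + δ (3 + m) v))
  summand≡indicators v rewrite ≟ᶠ-toℕ u v | label≡φ v | m<n⇒m%n≡m (toℕ<n v) =
    indicator-∨-split e (nbr 1) (nbr 2) (nbr (4 + m)) (nbr (3 + m)) φ (toℕ v)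
      (e≢nbr z<s 1<N) (e≢nbr z<s 2<N) (e≢nbr z<s N-1<N) (e≢nbr z<s N-2<N)
      (distinct 1<2 2<N) (distinct (<-trans 1<N-2 N-2<N-1) N-1<N) (distinct 1<N-2 N-2<N)
      (distinct (<-trans 2<N-2 N-2<N-1) N-1<N) (distinct 2<N-2 N-2<N) (≢-sym (distinct N-2<N-1 N-1<N))
    where
    1<2 : 1 < 2
    1<2 = s<s z<s
    1<N-2 : 1 < 3 + m
    1<N-2 = s<s z<s
    2<N-2 : 2 < 3 + m
    2<N-2 = s<s (s<s z<s)
    N-2<N-1 : 3 + m < 4 + m
    N-2<N-1 = n<1+n (3 + m)
    N-1<N : 4 + m < N
    N-1<N = n<1+n (4 + m)
    N-2<N : 3 + m < N
    N-2<N = <-trans N-2<N-1 N-1<N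
    1<N : 1 < N
    1<N = <-trans 1<N-2 N-2<N
    2<N : 2 < N
    2<N = <-trans 2<N-2 N-2<N

module _ (m : ℕ) (φ : ℕ → ℕ) where
  private
    N = 5 + m

    %-below : ∀ {x y} → x ≡ y → y < N → x % N ≡ y
    %-below refl = m<n⇒m%n≡m

    %-wrap : ∀ {x y} → x ≡ y + N → y < N → x % N ≡ y
    %-wrap {y = y} refl y<N = trans ([m+n]%n≡m%n y N) (m<n⇒m%n≡m y<N)

    cyclicNbrSum-at : ∀ x {a b c d} → (x + 1) % N ≡ a → (x + 2) % N ≡ b → (x + (4 + m)) % N ≡ c →
                      (x + (3 + m)) % N ≡ d → cyclicNbrSum N φ x ≡ φ a + (φ b + (φ c + φ d))
    cyclicNbrSum-at x refl refl refl refl = refl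

    +-suc² : ∀ a b → 2 + a + b ≡ a + (2 + b)
    +-suc² a b = sym (trans (+-suc a (suc b)) (cong suc (+-suc a b)))

    below-N : ∀ {j} → j ≤ 4 → j < N
    below-N j≤4 = s≤s (≤-trans j≤4 (m≤m+n 4 m))

    +m-below-N : ∀ {j} → j ≤ 4 → j + m < N
    +m-below-N j≤4 = s≤s (+-monoˡ-≤ m j≤4)

    1≤4 : 1 ≤ 4
    1≤4 = s≤s z≤n
    2≤4 : 2 ≤ 4
    2≤4 = s≤s (s≤s z≤n)
    3≤4 : 3 ≤ 4
    3≤4 = s≤s (s≤s (s≤s z≤n))

  cyclicNbrSum-interior : ∀ y → y ≤ m →
                          cyclicNbrSum N φ (2 + y) ≡ φ (3 + y) + (φ (4 + y) + (φ (1 + y) + φ y))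
  cyclicNbrSum-interior y y≤m = cyclicNbrSum-at (2 + y)
    (%-below (+-comm (2 + y) 1) (s<s (s<s (s<s (s<s (m≤n⇒m≤1+n y≤m))))))
    (%-below (+-comm (2 + y) 2) (s<s (s<s (s<s (s<s (s<s y≤m))))))
    (%-wrap (sym (+-suc (1 + y) (4 + m))) (s<s (s<s (m≤n⇒m≤o+n 3 y≤m))))
    (%-wrap (+-suc² y (3 + m)) (s<s (m≤n⇒m≤o+n 4 y≤m)))

  cyclicNbrSum-0 : cyclicNbrSum N φ 0 ≡ φ 1 + (φ 2 + (φ (4 + m) + φ (3 + m)))
  cyclicNbrSum-0 = cyclicNbrSum-at 0
    (%-below refl (below-N 1≤4)) (%-below refl (below-N 2≤4))
    (%-below refl (+m-below-N ≤-refl)) (%-below refl (+m-below-N 3≤4))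

  cyclicNbrSum-1 : cyclicNbrSum N φ 1 ≡ φ 2 + (φ 3 + (φ 0 + φ (4 + m)))
  cyclicNbrSum-1 = cyclicNbrSum-at 1
    (%-below refl (below-N 2≤4)) (%-below refl (below-N 3≤4))
    (%-wrap refl (below-N z≤n)) (%-below refl (+m-below-N ≤-refl))

  cyclicNbrSum-[N-2] : cyclicNbrSum N φ (3 + m) ≡ φ (4 + m) + (φ 0 + (φ (2 + m) + φ (1 + m)))
  cyclicNbrSum-[N-2] = cyclicNbrSum-at (3 + m)
    (%-below (+-comm (3 + m) 1) (+m-below-N ≤-refl))
    (%-wrap (+-comm (3 + m) 2) (below-N z≤n))
    (%-wrap (sym (+-suc (2 + m) (4 + m))) (+m-below-N 2≤4))
    (%-wrap (+-suc² (1 + m) (3 + m)) (+m-below-N 1≤4))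

  cyclicNbrSum-[N-1] : cyclicNbrSum N φ (4 + m) ≡ φ 0 + (φ 1 + (φ (3 + m) + φ (2 + m)))
  cyclicNbrSum-[N-1] = cyclicNbrSum-at (4 + m)
    (%-wrap (+-comm (4 + m) 1) (below-N z≤n))
    (%-wrap (+-comm (4 + m) 2) (below-N 1≤4))
    (%-wrap (sym (+-suc (3 + m) (4 + m))) (+m-below-N 3≤4))
    (%-wrap (+-suc² (2 + m) (3 + m)) (+m-below-N 2≤4))

-- The ring solver needs both sides of the equation fixed, so callers pass m and n explicitly.
<-witness : ∀ {m n} d → suc m + d ≡ n → m < n
<-witness {m} d refl = m≤m+n (suc m) d

≤-split : ∀ m n → (∃ λ p → m + p ≡ n) ⊎ (∃ λ t → suc n + t ≡ m)
≤-split m n with m ≤? n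
... | yes m≤n = inj₁ (m≤n⇒∃[o]m+o≡n m≤n)
... | no m≰n  = inj₂ (m≤n⇒∃[o]m+o≡n (≰⇒> m≰n))

data Parity : ℕ → Set where
  even : ∀ j → Parity (j + j)
  odd  : ∀ j → Parity (suc (j + j))

parity : ∀ n → Parity n
parity zero = even 0
parity (suc n) with parity n
... | even j = odd j
... | odd j rewrite sym (+-suc j j) = even (suc j)

-- The labelling

-- labelling k x = L(x) = f(v_x) − 1; p = k − q is carried along so that no subtraction occurs.
blockLabel : (k q p r : ℕ) → ℕ
blockLabel k q p 0 = q
blockLabel k q p 1 = suc k + (suc k + p)
blockLabel k q p 2 = suc k + p
blockLabel k q p 3 = suc k + (suc k + (suc k + q))
blockLabel k q p (suc (suc (suc (suc r)))) = blockLabel k (suc q) (pred p) r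

labelling : ℕ → ℕ → ℕ
labelling k = blockLabel k 0 k

blockLabel-shift : ∀ k a b q r → blockLabel k a (q + b) (q * 4 + r) ≡ blockLabel k (q + a) b r
blockLabel-shift k a b zero    r = refl
blockLabel-shift k a b (suc q) r =
  trans (blockLabel-shift k (suc a) b q r) (cong (λ c → blockLabel k c b r) (+-suc q a))

labelling-block : ∀ {k} q p r → q + p ≡ k → labelling k (r + q * 4) ≡ blockLabel k q p r
labelling-block {k} q p r refl = begin
  blockLabel k 0 (q + p) (r + q * 4)   ≡⟨ cong (blockLabel k 0 (q + p)) (+-comm r (q * 4)) ⟩
  blockLabel k 0 (q + p) (q * 4 + r)   ≡⟨ blockLabel-shift k 0 p q r ⟩
  blockLabel k (q + 0) p r             ≡⟨ cong (λ c → blockLabel k c p r) (+-identityʳ q) ⟩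
  blockLabel k q p r                   ∎
  where open ≡-Reasoning

data Position (k : ℕ) : ℕ → Set where
  pos₀ : ∀ q p → q + p ≡ k → Position k (q * 4)
  pos₁ : ∀ q p → q + p ≡ k → Position k (1 + q * 4)
  pos₂ : ∀ q p → q + p ≡ k → Position k (2 + q * 4)
  pos₃ : ∀ q p → q + suc p ≡ k → Position k (3 + q * 4)

position : ∀ k x → x < 3 + k * 4 → Position k x
position k       0 _ = pos₀ 0 k refl
position k       1 _ = pos₁ 0 k refl
position k       2 _ = pos₂ 0 k refl
position zero    3 (s<s (s<s (s<s ())))
position (suc k) 3 _ = pos₃ 0 k refl
position (suc k) (suc (suc (suc (suc x)))) (s<s (s<s (s<s (s<s x<n)))) with position k x x<n
... | pos₀ q p refl = pos₀ (suc q) p refl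
... | pos₁ q p refl = pos₁ (suc q) p refl
... | pos₂ q p refl = pos₂ (suc q) p refl
... | pos₃ q p refl = pos₃ (suc q) p refl

Position⇒< : ∀ {k x} → Position k x → x < 3 + k * 4
Position⇒< (pos₀ q p refl) = <-witness {q * 4} {3 + (q + p) * 4} (2 + p * 4) (solve (q ∷ p ∷ []))
Position⇒< (pos₁ q p refl) = <-witness {1 + q * 4} {3 + (q + p) * 4} (1 + p * 4) (solve (q ∷ p ∷ []))
Position⇒< (pos₂ q p refl) = <-witness {2 + q * 4} {3 + (q + p) * 4} (p * 4) (solve (q ∷ p ∷ []))
Position⇒< (pos₃ q p refl) = <-witness {3 + q * 4} {3 + (q + suc p) * 4} (3 + p * 4) (solve (q ∷ p ∷ []))

labelling-< : ∀ {k x} → Position k x → labelling k x < 3 + k * 4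
labelling-< (pos₀ q p refl) rewrite labelling-block q p 0 refl =
  <-witness {q} {3 + (q + p) * 4} (2 + q * 3 + p * 4) (solve (q ∷ p ∷ []))
labelling-< (pos₁ q p refl) rewrite labelling-block q p 1 refl =
  <-witness {suc (q + p) + (suc (q + p) + p)} {3 + (q + p) * 4} (q * 2 + p) (solve (q ∷ p ∷ []))
labelling-< (pos₂ q p refl) rewrite labelling-block q p 2 refl =
  <-witness {suc (q + p) + p} {3 + (q + p) * 4} (1 + q * 3 + p * 2) (solve (q ∷ p ∷ []))
labelling-< (pos₃ q p refl) rewrite labelling-block q (suc p) 3 refl =
  <-witness {suc (q + suc p) + (suc (q + suc p) + (suc (q + suc p) + q))} {3 + (q + suc p) * 4} p
    (solve (q ∷ p ∷ []))

labelling-surjective : ∀ k l → l < 3 + k * 4 → ∃ λ x → Position k x × labelling k x ≡ l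
labelling-surjective k l l<N with ≤-split l k
... | inj₁ (p , e) = l * 4 , pos₀ l p e , labelling-block l p 0 e
... | inj₂ (t , refl) with ≤-split t k
...   | inj₁ (p , e) = 2 + p * 4 , pos₂ p t e′ , labelling-block p t 2 e′
  where e′ = trans (+-comm p t) e
...   | inj₂ (t′ , refl) with ≤-split t′ k
...     | inj₁ (p , e) = 1 + p * 4 , pos₁ p t′ e′ , labelling-block p t′ 1 e′
  where e′ = trans (+-comm p t′) e
...     | inj₂ (t″ , refl) with ≤-split (suc t″) k
...       | inj₁ (p , e) = 3 + t″ * 4 , pos₃ t″ p e′ , labelling-block t″ (suc p) 3 e′
  where e′ = trans (+-suc t″ p) e
...       | inj₂ (d , refl) = contradiction (subst (_< 3 + k * 4) overflow l<N) (m+n≮m (3 + k * 4) d)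
  where
  overflow : suc k + (suc k + (suc k + (k + d))) ≡ 3 + k * 4 + d
  overflow = solve (k ∷ d ∷ [])

-- The weights

vertexWeight : ℕ → ℕ → ℕ
vertexWeight k = cyclicNbrSum (3 + k * 4) (suc ∘ labelling k)

sucSum-cong : ∀ {a b c d a′ b′ c′ d′} → a ≡ a′ → b ≡ b′ → c ≡ c′ → d ≡ d′ →
              suc a + (suc b + (suc c + suc d)) ≡ suc a′ + (suc b′ + (suc c′ + suc d′))
sucSum-cong refl refl refl refl = refl

-- k is let-bound, not where-bound: the ring solver would treat a where-bound k as a constant.
weight-at-0 : ∀ K → let k = suc K in vertexWeight k 0 ≡ 7 + k * 6 + (3 + (k + k))
weight-at-0 K = let k = suc K; φ = suc ∘ labelling k in begin
  vertexWeight k 0                                  ≡⟨ cyclicNbrSum-0 (2 + K * 4) φ ⟩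
  φ 1 + (φ 2 + (φ (2 + k * 4) + φ (1 + k * 4)))
    ≡⟨ sucSum-cong (labelling-block 0 k 1 refl) (labelling-block 0 k 2 refl)
                   (labelling-block k 0 2 (+-identityʳ k)) (labelling-block k 0 1 (+-identityʳ k)) ⟩
  suc (suc k + (suc k + k)) + (suc (suc k + k) + (suc (suc k + 0) + suc (suc k + (suc k + 0))))
    ≡⟨ solve (K ∷ []) ⟩
  7 + k * 6 + (3 + (k + k)) ∎
  where open ≡-Reasoning

weight-at-1 : ∀ K → let k = suc K in vertexWeight k 1 ≡ 7 + k * 6 + 2
weight-at-1 K = let k = suc K; φ = suc ∘ labelling k in begin
  vertexWeight k 1                                  ≡⟨ cyclicNbrSum-1 (2 + K * 4) φ ⟩
  φ 2 + (φ 3 + (φ 0 + φ (2 + k * 4)))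
    ≡⟨ sucSum-cong (labelling-block 0 k 2 refl) (labelling-block 0 k 3 refl)
                   (labelling-block 0 k 0 refl) (labelling-block k 0 2 (+-identityʳ k)) ⟩
  suc (suc k + k) + (suc (suc k + (suc k + (suc k + 0))) + (suc 0 + suc (suc k + 0)))
    ≡⟨ solve (K ∷ []) ⟩
  7 + k * 6 + 2 ∎
  where open ≡-Reasoning

weight-at-last : ∀ K → let k = suc K in vertexWeight k (2 + k * 4) ≡ 7 + k * 6 + 1
weight-at-last K = let k = suc K; φ = suc ∘ labelling k in begin
  vertexWeight k (2 + k * 4)                        ≡⟨ cyclicNbrSum-[N-1] (2 + K * 4) φ ⟩
  φ 0 + (φ 1 + (φ (1 + k * 4) + φ (k * 4)))
    ≡⟨ sucSum-cong (labelling-block 0 k 0 refl) (labelling-block 0 k 1 refl)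
                   (labelling-block k 0 1 (+-identityʳ k)) (labelling-block k 0 0 (+-identityʳ k)) ⟩
  suc 0 + (suc (suc k + (suc k + k)) + (suc (suc k + (suc k + 0)) + suc k))
    ≡⟨ solve (K ∷ []) ⟩
  7 + k * 6 + 1 ∎
  where open ≡-Reasoning

weight-at-penultimate : ∀ K → let k = suc K in vertexWeight k (1 + k * 4) ≡ 7 + k * 6 + 0
weight-at-penultimate K = let k = suc K; φ = suc ∘ labelling k in begin
  vertexWeight k (1 + k * 4)                        ≡⟨ cyclicNbrSum-[N-2] (2 + K * 4) φ ⟩
  φ (2 + k * 4) + (φ 0 + (φ (k * 4) + φ (3 + K * 4)))
    ≡⟨ sucSum-cong (labelling-block k 0 2 (+-identityʳ k)) (labelling-block 0 k 0 refl)
                   (labelling-block k 0 0 (+-identityʳ k)) (labelling-block K 1 3 (+-comm K 1)) ⟩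
  suc (suc k + 0) + (suc 0 + (suc k + suc (suc k + (suc k + (suc k + K)))))
    ≡⟨ solve (K ∷ []) ⟩
  7 + k * 6 + 0 ∎
  where open ≡-Reasoning

q*4≤[q+p]*4 : ∀ q p → q * 4 ≤ (q + p) * 4
q*4≤[q+p]*4 q p = *-monoˡ-≤ 4 (m≤m+n q p)

-- The interior lemmas receive k as a polynomial in q and p, so that N = 3 + 4k reduces to the
-- form 5 + m of the cycle lemmas and the ring solver can close the computation.
weight-at-4q+2 : ∀ {k} q p → suc (q + p) ≡ k → vertexWeight k (2 + q * 4) ≡ 7 + k * 6 + (3 + (q + q))
weight-at-4q+2 q p refl = let k = suc (q + p); φ = suc ∘ labelling k in begin
  vertexWeight k (2 + q * 4)
    ≡⟨ cyclicNbrSum-interior (2 + (q + p) * 4) φ (q * 4) (m≤n⇒m≤o+n 2 (q*4≤[q+p]*4 q p)) ⟩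
  φ (3 + q * 4) + (φ (suc q * 4) + (φ (1 + q * 4) + φ (q * 4)))
    ≡⟨ sucSum-cong (labelling-block q (suc p) 3 (+-suc q p)) (labelling-block (suc q) p 0 refl)
                   (labelling-block q (suc p) 1 (+-suc q p)) (labelling-block q (suc p) 0 (+-suc q p)) ⟩
  suc (suc k + (suc k + (suc k + q))) + (suc (suc q) + (suc (suc k + (suc k + suc p)) + suc q))
    ≡⟨ solve (q ∷ p ∷ []) ⟩
  7 + k * 6 + (3 + (q + q)) ∎
  where open ≡-Reasoning

weight-at-4q+3 : ∀ {k} q p → suc (q + p) ≡ k → vertexWeight k (3 + q * 4) ≡ 7 + k * 6 + (4 + (p + p))
weight-at-4q+3 q p refl = let k = suc (q + p); φ = suc ∘ labelling k in begin
  vertexWeight k (3 + q * 4)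
    ≡⟨ cyclicNbrSum-interior (2 + (q + p) * 4) φ (1 + q * 4) (m≤n⇒m≤1+n (s≤s (q*4≤[q+p]*4 q p))) ⟩
  φ (suc q * 4) + (φ (1 + suc q * 4) + (φ (2 + q * 4) + φ (1 + q * 4)))
    ≡⟨ sucSum-cong (labelling-block (suc q) p 0 refl) (labelling-block (suc q) p 1 refl)
                   (labelling-block q (suc p) 2 (+-suc q p)) (labelling-block q (suc p) 1 (+-suc q p)) ⟩
  suc (suc q) + (suc (suc k + (suc k + p)) + (suc (suc k + suc p) + suc (suc k + (suc k + suc p))))
    ≡⟨ solve (q ∷ p ∷ []) ⟩
  7 + k * 6 + (4 + (p + p)) ∎
  where open ≡-Reasoning

weight-at-4q : ∀ {k} q p → suc (q + p) ≡ k →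
               vertexWeight k (suc q * 4) ≡ 7 + k * 6 + (4 + ((k + p) + (k + p)))
weight-at-4q q p refl = let k = suc (q + p); φ = suc ∘ labelling k in begin
  vertexWeight k (suc q * 4)
    ≡⟨ cyclicNbrSum-interior (2 + (q + p) * 4) φ (2 + q * 4) (s≤s (s≤s (q*4≤[q+p]*4 q p))) ⟩
  φ (1 + suc q * 4) + (φ (2 + suc q * 4) + (φ (3 + q * 4) + φ (2 + q * 4)))
    ≡⟨ sucSum-cong (labelling-block (suc q) p 1 refl) (labelling-block (suc q) p 2 refl)
                   (labelling-block q (suc p) 3 (+-suc q p)) (labelling-block q (suc p) 2 (+-suc q p)) ⟩
  suc (suc k + (suc k + p)) + (suc (suc k + p) + (suc (suc k + (suc k + (suc k + q))) + suc (suc k + suc p)))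
    ≡⟨ solve (q ∷ p ∷ []) ⟩
  7 + k * 6 + (4 + ((k + p) + (k + p))) ∎
  where open ≡-Reasoning

weight-at-4q+1 : ∀ {k} q p → suc (suc (q + p)) ≡ k →
                 vertexWeight k (1 + suc q * 4) ≡ 7 + k * 6 + (3 + ((k + suc q) + (k + suc q)))
weight-at-4q+1 q p refl =
  let k = suc (suc (q + p)); φ = suc ∘ labelling k; e = cong suc (+-suc q p) in begin
  vertexWeight k (1 + suc q * 4)
    ≡⟨ cyclicNbrSum-interior (2 + suc (q + p) * 4) φ (3 + q * 4)
         (s≤s (s≤s (s≤s (m≤n⇒m≤o+n 3 (q*4≤[q+p]*4 q p))))) ⟩
  φ (2 + suc q * 4) + (φ (3 + suc q * 4) + (φ (suc q * 4) + φ (3 + q * 4)))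
    ≡⟨ sucSum-cong (labelling-block (suc q) (suc p) 2 e) (labelling-block (suc q) (suc p) 3 e)
                   (labelling-block (suc q) (suc p) 0 e)
                   (labelling-block q (suc (suc p)) 3 (trans (+-suc q (suc p)) e)) ⟩
  suc (suc k + suc p) +
    (suc (suc k + (suc k + (suc k + suc q))) + (suc (suc q) + suc (suc k + (suc k + (suc k + q)))))
    ≡⟨ solve (q ∷ p ∷ []) ⟩
  7 + k * 6 + (3 + ((k + suc q) + (k + suc q))) ∎
  where open ≡-Reasoning

weight-in-range : ∀ {K x} → Position (suc K) x →
                  ∃ λ w → w < 3 + suc K * 4 × vertexWeight (suc K) x ≡ 7 + suc K * 6 + w
weight-in-range (pos₀ zero zero ())
weight-in-range (pos₀ zero (suc K) refl) =
  _ , <-witness {3 + (suc K + suc K)} {3 + suc K * 4} (1 + K * 2) (solve (K ∷ [])) , weight-at-0 K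
weight-in-range (pos₀ (suc q) p refl) =
  _ , <-witness {4 + ((suc (q + p) + p) + (suc (q + p) + p))} {3 + suc (q + p) * 4} (q * 2)
                (solve (q ∷ p ∷ [])) ,
  weight-at-4q q p refl
weight-in-range (pos₁ zero zero ())
weight-in-range (pos₁ zero (suc K) refl) =
  _ , <-witness {2} {3 + suc K * 4} (suc K * 4) (solve (K ∷ [])) , weight-at-1 K
weight-in-range (pos₁ (suc K) zero refl) rewrite +-identityʳ K =
  _ , <-witness {0} {3 + suc K * 4} (2 + suc K * 4) (solve (K ∷ [])) , weight-at-penultimate K
weight-in-range (pos₁ (suc q) (suc p) refl) = let k = suc q + suc p in
  _ , <-witness {3 + ((k + suc q) + (k + suc q))} {3 + k * 4} (1 + p * 2) (solve (q ∷ p ∷ [])) ,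
  weight-at-4q+1 q p (cong suc (sym (+-suc q p)))
weight-in-range (pos₂ zero zero ())
weight-in-range (pos₂ (suc K) zero refl) rewrite +-identityʳ K =
  _ , <-witness {1} {3 + suc K * 4} (1 + suc K * 4) (solve (K ∷ [])) , weight-at-last K
weight-in-range (pos₂ q (suc p) e) rewrite sym (suc-injective (trans (sym (+-suc q p)) e)) =
  _ , <-witness {3 + (q + q)} {3 + suc (q + p) * 4} (3 + q * 2 + p * 4) (solve (q ∷ p ∷ [])) ,
  weight-at-4q+2 q p refl
weight-in-range (pos₃ q p e) rewrite sym (suc-injective (trans (sym (+-suc q p)) e)) =
  _ , <-witness {4 + (p + p)} {3 + suc (q + p) * 4} (2 + q * 4 + p * 2) (solve (q ∷ p ∷ [])) ,
  weight-at-4q+3 q p refl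

weight-attained : ∀ K w → w < 3 + suc K * 4 →
                  ∃ λ x → Position (suc K) x × vertexWeight (suc K) x ≡ 7 + suc K * 6 + w
weight-attained K 0 _ = _ , pos₁ (suc K) 0 (+-identityʳ (suc K)) , weight-at-penultimate K
weight-attained K 1 _ = _ , pos₂ (suc K) 0 (+-identityʳ (suc K)) , weight-at-last K
weight-attained K 2 _ = _ , pos₁ 0 (suc K) refl , weight-at-1 K
weight-attained K (suc (suc (suc w))) w<N with parity w
... | even j with ≤-split j K
...   | inj₁ (p , e) =
  _ , pos₂ j (suc p) (trans (+-suc j p) (cong suc e)) , weight-at-4q+2 j p (cong suc e)
...   | inj₂ (zero , refl) rewrite +-identityʳ K = _ , pos₀ 0 (suc K) refl , weight-at-0 K
...   | inj₂ (suc t , refl) with ≤-split (suc t) K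
...     | inj₁ (p , e) =
  _ , pos₁ (suc t) (suc p) (cong suc (trans (+-suc t p) e)) , weight-at-4q+1 t p (cong suc e)
...     | inj₂ (d , refl) = contradiction (subst (_< 3 + suc K * 4) overflow w<N) (m+n≮m _ (d + d))
  where
  overflow : 3 + ((suc K + suc (K + d)) + (suc K + suc (K + d))) ≡ 3 + suc K * 4 + (d + d)
  overflow = solve (K ∷ d ∷ [])
weight-attained K (suc (suc (suc w))) w<N | odd j with ≤-split j K
...   | inj₁ (q , e) = _ , pos₃ q j (trans (+-suc q j) e′) , weight-at-4q+3 q j e′
  where e′ = cong suc (trans (+-comm q j) e)
...   | inj₂ (t , refl) with ≤-split t K
...     | inj₁ (q , e) = _ , pos₀ (suc q) t e′ , weight-at-4q q t e′
  where e′ = cong suc (trans (+-comm q t) e)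
...     | inj₂ (d , refl) = contradiction (subst (_< 3 + suc K * 4) overflow w<N) (m+n≮m _ (suc (d + d)))
  where
  overflow : 4 + ((suc K + (suc K + d)) + (suc K + (suc K + d))) ≡ 3 + suc K * 4 + suc (d + d)
  overflow = solve (K ∷ d ∷ [])

H4-antimagic : ∀ K → let k = suc K in H4DistAntimagic (3 + k * 4) (ℤ.+ (7 + k * 6)) 1
H4-antimagic K = ↔⇒⤖ (mk↔ₛ′ g g⁻¹ g∘g⁻¹ (rightInverse⇒leftInverse g g⁻¹ g∘g⁻¹)) , in-range , attained
  where
  k = suc K
  N = 3 + k * 4
  a = 7 + k * 6

  g : Fin N → Fin N
  g v = fromℕ< (labelling-< (position k (toℕ v) (toℕ<n v)))

  toℕ-g : ∀ v → toℕ (g v) ≡ labelling k (toℕ v)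
  toℕ-g v = toℕ-fromℕ< _

  preimage : ∀ (l : Fin N) → ∃ λ x → Position k x × labelling k x ≡ toℕ l
  preimage l = labelling-surjective k (toℕ l) (toℕ<n l)

  g⁻¹ : Fin N → Fin N
  g⁻¹ l = let _ , pos , _ = preimage l in fromℕ< (Position⇒< pos)

  g∘g⁻¹ : ∀ l → g (g⁻¹ l) ≡ l
  g∘g⁻¹ l = let _ , pos , labelling≡l = preimage l in
    toℕ-injective (trans (toℕ-g (g⁻¹ l))
                         (trans (cong (labelling k) (toℕ-fromℕ< (Position⇒< pos))) labelling≡l))

  weight≡vertexWeight : ∀ u → weight N g u ≡ vertexWeight k (toℕ u)
  weight≡vertexWeight = weight≡cyclicNbrSum (2 + K * 4) g (suc ∘ labelling k) (λ v → cong suc (toℕ-g v))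

  -- Destructured by let: a with-abstraction would normalise weight N g u in the goal, at great cost.
  in-range : ∀ u → ∃ λ (j : Fin N) → ℤ.+ weight N g u ≡ ℤ.+ a ℤ.+ ℤ.+ (toℕ j * 1)
  in-range u = let w , w<N , eq = weight-in-range (position k (toℕ u) (toℕ<n u)) in
    fromℕ< w<N , cong ℤ.+_ (trans (weight≡vertexWeight u)
                   (trans eq (cong (_+_ a) (sym (trans (*-identityʳ _) (toℕ-fromℕ< w<N))))))

  attained : ∀ j → ∃ λ (u : Fin N) → ℤ.+ weight N g u ≡ ℤ.+ a ℤ.+ ℤ.+ (toℕ j * 1)
  attained j = let x , pos , eq = weight-attained K (toℕ j) (toℕ<n j); u = fromℕ< (Position⇒< pos) in
    u , cong ℤ.+_ (trans (weight≡vertexWeight u)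
                    (trans (cong (vertexWeight k) (toℕ-fromℕ< (Position⇒< pos)))
                           (trans eq (cong (_+_ a) (sym (*-identityʳ (toℕ j)))))))

-- For n = 3 the offsets ±1, ±2 name only the two other vertices: H_{4,3} is a triangle.
H4-triangle-antimagic : H4DistAntimagic 3 (ℤ.+ 3) 1
H4-triangle-antimagic = ↔⇒⤖ (mk↔ₛ′ id id (λ _ → refl) (λ _ → refl)) , in-range , attained
  where
  in-range : ∀ u → ∃ λ (j : Fin 3) → ℤ.+ weight 3 id u ≡ ℤ.+ 3 ℤ.+ ℤ.+ (toℕ j * 1)
  in-range fzero               = fsuc (fsuc fzero) , refl
  in-range (fsuc fzero)        = fsuc fzero , refl
  in-range (fsuc (fsuc fzero)) = fzero , refl

  attained : ∀ j → ∃ λ (u : Fin 3) → ℤ.+ weight 3 id u ≡ ℤ.+ 3 ℤ.+ ℤ.+ (toℕ j * 1)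
  attained fzero               = fsuc (fsuc fzero) , refl
  attained (fsuc fzero)        = fsuc fzero , refl
  attained (fsuc (fsuc fzero)) = fzero , refl

H4-4k+3-antimagic : ∀ k → ∃ λ (a : ℤ) → H4DistAntimagic (3 + k * 4) a 1
H4-4k+3-antimagic zero    = ℤ.+ 3 , H4-triangle-antimagic
H4-4k+3-antimagic (suc K) = ℤ.+ (7 + suc K * 6) , H4-antimagic K

mainTheorem16 : (n : ℕ) → (suc n) % 4 ≡ 3 → ∃ λ (a : ℤ) → H4DistAntimagic (suc n) a 1
mainTheorem16 n h =
  subst (λ m → ∃ λ (a : ℤ) → H4DistAntimagic (suc m) a 1) (sym n≡2+q*4) (H4-4k+3-antimagic (suc n / 4))
  where
  n≡2+q*4 : n ≡ 2 + (suc n / 4) * 4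
  n≡2+q*4 = suc-injective (trans (m≡m%n+[m/n]*n (suc n) 4) (cong (_+ (suc n / 4) * 4) h))
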